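{- Let $k\ge 3$ be an integer. For the path graph $P_n$ of order $n\ge k+1$, $\dim_k(P_n)=k+1$.
   Context: For a connected graph with shortest-path distance $d$: a set $S$ of vertices is a $k$-metric generator if every pair of distinct vertices $x,y$ has at least $k$ elements $w\in S$ with $d(x,w)\ne d(y,w)$; $\dim_k$ is the minimum cardinality of a $k$-metric generator. -}

module Defs where

open import Data.Nat using (ℕ; zero; suc; _≤_; _+_)
open import Data.Fin using (Fin; toℕ)
open import Data.Fin.Subset using (Subset; _∈_; ∣_∣)
open import Data.Product using (Σ; _×_; ∃)
open import Data.Sum using (_⊎_)
open import Relation.Binary.PropositionalEquality using (_≡_)
open import Relation.Nullary using (¬_)

Graph : ℕ → Set₁
Graph n = Fin n → Fin n → Set

data Walk {n : ℕ} (G : Graph n) : Fin n → Fin n → ℕ → Set where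
  here : ∀ {x} → Walk G x x zero
  step : ∀ {x y z m} → G x y → Walk G y z m → Walk G x z (suc m)

IsShortestPathDistance : {n : ℕ} → Graph n → (Fin n → Fin n → ℕ) → Set
IsShortestPathDistance G d =
  ∀ x y → Walk G x y (d x y) × (∀ m → Walk G x y m → d x y ≤ m)

PathGraph : (n : ℕ) → Graph n
PathGraph n i j = (suc (toℕ i) ≡ toℕ j) ⊎ (suc (toℕ j) ≡ toℕ i)


IsKMetricGenerator : {n : ℕ} → (Fin n → Fin n → ℕ) → ℕ → Subset n → Set
IsKMetricGenerator {n} d k S =
  ∀ (x y : Fin n) → ¬ (x ≡ y) →
    Σ (Subset n) λ R →
      (k ≤ ∣ R ∣) × (∀ w → w ∈ R → (w ∈ S) × ¬ (d x w ≡ d y w))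

IsKMetricDimension : {n : ℕ} → (Fin n → Fin n → ℕ) → ℕ → ℕ → Set
IsKMetricDimension {n} d k m =
  (Σ (Subset n) λ S → IsKMetricGenerator d k S × ∣ S ∣ ≡ m)
  × (∀ S → IsKMetricGenerator d k S → m ≤ ∣ S ∣)

module Submission where

-- The shortest-path distance of P_n is d x y = ∣ x - y ∣ (pathDistance).  On ℕ two
-- distinct points a, b have at most one equidistant point c, namely the one with
-- a + b = c + c (equidistant-unique).  Hence every pair of distinct vertices of P_n
-- is resolved by all vertices but at most one, and for any distance function with
-- this property every set of at least k + 1 vertices is a k-metric generator
-- (largeSetsGenerate); an initial segment of size k + 1 gives the upper bound.
--
-- For the lower bound, a k-metric generator S has at least k ≥ 3 elements
-- (generatorSize), so it contains a vertex w other than the two endpoints.  Such an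
-- interior vertex is equidistant from its two neighbours (interiorVertexUnresolving),
-- so the k vertices of S resolving this pair all lie in S - w, which forces
-- k + 1 ≤ ∣ S ∣ (unresolvingMember).

open import Defs
open import Data.Nat using (ℕ; zero; suc; _≤_; _<_; _+_; _∸_; s≤s; s≤s⁻¹)
  renaming (∣_-_∣ to dist)
open import Data.Nat.Properties
open import Data.Fin using (Fin; toℕ; fromℕ<; fromℕ; inject₁; lower₁)
  renaming (zero to fz; suc to fs)
open import Data.Fin.Properties
  using (toℕ-injective; toℕ<n; toℕ-fromℕ<; toℕ-fromℕ; toℕ-inject₁; toℕ-lower₁; any?)
open import Data.Fin.Subset
  using (Subset; _∈_; _∉_; ∣_∣; _─_; _-_; ⁅_⁆; ⊥; inside; outside; _⊆_; Nonempty)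
open import Data.Fin.Subset.Properties
  using (p─q⊆p; p─⊥≡p; x∈⁅x⁆; x∈p∧x≢y⇒x∈p-y; x∈p⇒∣p-x∣<∣p∣; p⊆q⇒∣p∣≤∣q∣; ∣⊥∣≡0;
         nonempty?; Empty-unique)
open import Data.Vec using (_∷_)
open import Data.Vec.Base using (here; there)
open import Data.Product using (Σ; _×_; ∃₂; _,_; proj₁; proj₂)
open import Data.Sum using (inj₁; inj₂; swap)
open import Relation.Binary using (tri<; tri≈; tri>)
open import Relation.Binary.PropositionalEquality
open import Relation.Nullary using (¬_; yes; no; contradiction)

-- Notation: `dist` is ℕ's absolute difference ∣_-_∣, renamed because `∣ S - v ∣`
-- would otherwise be ambiguous with the size of the subset `S - v`.

∈─⇒∉ : ∀ {n} {x : Fin n} (p q : Subset n) → x ∈ p ─ q → x ∉ q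
∈─⇒∉ (inside ∷ p) (outside ∷ q) here ()
∈─⇒∉ (_ ∷ p) (_ ∷ q) (there x∈p─q) (there x∈q) = ∈─⇒∉ p q x∈p─q x∈q

∈-⇒≢ : ∀ {n} {x y : Fin n} (p : Subset n) → x ∈ p - y → x ≢ y
∈-⇒≢ {y = y} p x∈p-y refl = ∈─⇒∉ p ⁅ y ⁆ x∈p-y (x∈⁅x⁆ y)

∣p∣≤1+∣p-x∣ : ∀ {n} (p : Subset n) (x : Fin n) → ∣ p ∣ ≤ suc ∣ p - x ∣
∣p∣≤1+∣p-x∣ (inside ∷ p) fz = s≤s (≤-reflexive (cong ∣_∣ (sym (p─⊥≡p p))))
∣p∣≤1+∣p-x∣ (outside ∷ p) fz = ≤-trans (n≤1+n ∣ p ∣) (s≤s (≤-reflexive (cong ∣_∣ (sym (p─⊥≡p p)))))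
∣p∣≤1+∣p-x∣ (inside ∷ p) (fs x) = s≤s (∣p∣≤1+∣p-x∣ p x)
∣p∣≤1+∣p-x∣ (outside ∷ p) (fs x) = ∣p∣≤1+∣p-x∣ p x

positiveSize⇒nonempty : ∀ {n} (p : Subset n) → 1 ≤ ∣ p ∣ → Nonempty p
positiveSize⇒nonempty {n} p 1≤∣p∣ with nonempty? p
... | yes p≢∅ = p≢∅
... | no p≡∅ = contradiction (trans (cong ∣_∣ (Empty-unique p≡∅)) (∣⊥∣≡0 n)) (>⇒≢ 1≤∣p∣)

subsetOfSize : ∀ s n → s ≤ n → Σ (Subset n) λ S → ∣ S ∣ ≡ s
subsetOfSize zero n _ = ⊥ , ∣⊥∣≡0 n
subsetOfSize (suc s) (suc n) (s≤s s≤n) with subsetOfSize s n s≤n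
... | S , ∣S∣≡s = inside ∷ S , cong suc ∣S∣≡s

snoc : ∀ {n} {G : Graph n} {x y z m} → Walk G x y m → G y z → Walk G x z (suc m)
snoc here e = step e here
snoc (step e w) e′ = step e (snoc w e′)

reverse : ∀ {n} {G : Graph n} → (∀ {x y} → G x y → G y x) →
  ∀ {x y m} → Walk G x y m → Walk G y x m
reverse sym-G here = here
reverse sym-G (step e w) = snoc (reverse sym-G w) (sym-G e)

ascendingWalk : ∀ {n} m (x y : Fin n) → toℕ x + m ≡ toℕ y → Walk (PathGraph n) x y m
ascendingWalk zero x y x+0≡y =
  subst (λ z → Walk _ x z zero) (toℕ-injective (trans (sym (+-identityʳ (toℕ x))) x+0≡y)) here
ascendingWalk {n} (suc m) x y x+m+1≡y =
  step (inj₁ (sym (toℕ-fromℕ< next<n))) (ascendingWalk m (fromℕ< next<n) y next+m≡y)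
  where
  open ≤-Reasoning
  next<n : suc (toℕ x) < n
  next<n = begin-strict
    suc (toℕ x)      ≤⟨ s≤s (m≤m+n (toℕ x) m) ⟩
    suc (toℕ x + m)  ≡⟨ sym (+-suc (toℕ x) m) ⟩
    toℕ x + suc m    ≡⟨ x+m+1≡y ⟩
    toℕ y            <⟨ toℕ<n y ⟩
    n                ∎
  next+m≡y : toℕ (fromℕ< next<n) + m ≡ toℕ y
  next+m≡y = trans (cong (_+ m) (toℕ-fromℕ< next<n)) (trans (sym (+-suc (toℕ x) m)) x+m+1≡y)

geodesic : ∀ {n} (x y : Fin n) → Walk (PathGraph n) x y (dist (toℕ x) (toℕ y))
geodesic x y with ≤-total (toℕ x) (toℕ y)
... | inj₁ x≤y = subst (Walk _ x y) (sym (m≤n⇒∣m-n∣≡n∸m x≤y))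
  (ascendingWalk _ x y (m+[n∸m]≡n x≤y))
... | inj₂ y≤x = subst (Walk _ x y) (sym (m≤n⇒∣n-m∣≡n∸m y≤x))
  (reverse swap (ascendingWalk _ y x (m+[n∸m]≡n y≤x)))

∣n-1+n∣≡1 : ∀ t → dist t (suc t) ≡ 1
∣n-1+n∣≡1 zero = refl
∣n-1+n∣≡1 (suc t) = ∣n-1+n∣≡1 t

adjacent⇒dist≡1 : ∀ {n} {x y : Fin n} → PathGraph n x y → dist (toℕ x) (toℕ y) ≡ 1
adjacent⇒dist≡1 {x = x} (inj₁ x+1≡y) =
  trans (cong (dist (toℕ x)) (sym x+1≡y)) (∣n-1+n∣≡1 (toℕ x))
adjacent⇒dist≡1 {y = y} (inj₂ y+1≡x) =
  trans (cong (λ t → dist t (toℕ y)) (sym y+1≡x))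
        (trans (∣-∣-comm (suc (toℕ y)) (toℕ y)) (∣n-1+n∣≡1 (toℕ y)))

-- Each step changes the index by one, so no walk is shorter than dist x y.
walk⇒dist≤length : ∀ {n} {x y : Fin n} {m} → Walk (PathGraph n) x y m →
  dist (toℕ x) (toℕ y) ≤ m
walk⇒dist≤length {x = x} here = ≤-reflexive (∣n-n∣≡0 (toℕ x))
walk⇒dist≤length {x = x} {z} (step {y = y} e w) = begin
  dist (toℕ x) (toℕ z)                         ≤⟨ ∣-∣-triangle (toℕ x) (toℕ y) (toℕ z) ⟩
  dist (toℕ x) (toℕ y) + dist (toℕ y) (toℕ z)  ≡⟨ cong (_+ dist (toℕ y) (toℕ z)) (adjacent⇒dist≡1 e) ⟩
  suc (dist (toℕ y) (toℕ z))                   ≤⟨ s≤s (walk⇒dist≤length w) ⟩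
  suc _                                        ∎
  where open ≤-Reasoning

pathDistance : ∀ {n} {d : Fin n → Fin n → ℕ} → IsShortestPathDistance (PathGraph n) d →
  ∀ x y → d x y ≡ dist (toℕ x) (toℕ y)
pathDistance sp x y =
  ≤-antisym (proj₂ (sp x y) _ (geodesic x y)) (walk⇒dist≤length (proj₁ (sp x y)))

crossing : ∀ {a b c} → b ≤ c → c ≤ a → a ∸ c ≡ c ∸ b → a + b ≡ c + c
crossing {a} {b} {c} b≤c c≤a eq = begin
  a + b                ≡⟨ cong (_+ b) (sym (m∸n+n≡m c≤a)) ⟩
  (a ∸ c + c) + b      ≡⟨ cong (λ t → t + c + b) eq ⟩
  (c ∸ b + c) + b      ≡⟨ +-assoc (c ∸ b) c b ⟩
  c ∸ b + (c + b)      ≡⟨ cong (c ∸ b +_) (+-comm c b) ⟩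
  c ∸ b + (b + c)      ≡⟨ sym (+-assoc (c ∸ b) b c) ⟩
  (c ∸ b + b) + c      ≡⟨ cong (_+ c) (m∸n+n≡m b≤c) ⟩
  c + c                ∎
  where open ≡-Reasoning

equidistant⇒midpoint : ∀ a b c → dist a c ≡ dist b c → a ≢ b → a + b ≡ c + c
equidistant⇒midpoint a b c eq a≢b with ≤-total c a | ≤-total c b
... | inj₁ c≤a | inj₁ c≤b = contradiction (∸-cancelʳ-≡ c≤a c≤b
      (trans (sym (m≤n⇒∣n-m∣≡n∸m c≤a)) (trans eq (m≤n⇒∣n-m∣≡n∸m c≤b)))) a≢b
... | inj₂ a≤c | inj₂ b≤c = contradiction (∸-cancelˡ-≡ a≤c b≤c
      (trans (sym (m≤n⇒∣m-n∣≡n∸m a≤c)) (trans eq (m≤n⇒∣m-n∣≡n∸m b≤c)))) a≢b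
... | inj₁ c≤a | inj₂ b≤c = crossing b≤c c≤a
      (trans (sym (m≤n⇒∣n-m∣≡n∸m c≤a)) (trans eq (m≤n⇒∣m-n∣≡n∸m b≤c)))
... | inj₂ a≤c | inj₁ c≤b = trans (+-comm a b) (crossing a≤c c≤b
      (trans (sym (m≤n⇒∣n-m∣≡n∸m c≤b)) (trans (sym eq) (m≤n⇒∣m-n∣≡n∸m a≤c))))

c+c-injective : ∀ c c′ → c + c ≡ c′ + c′ → c ≡ c′
c+c-injective c c′ eq with <-cmp c c′
... | tri< c<c′ _ _ = contradiction eq (<⇒≢ (+-mono-< c<c′ c<c′))
... | tri≈ _ c≡c′ _ = c≡c′
... | tri> _ _ c′<c = contradiction (sym eq) (<⇒≢ (+-mono-< c′<c c′<c))

equidistant-unique : ∀ a b c c′ → a ≢ b →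
  dist a c ≡ dist b c → dist a c′ ≡ dist b c′ → c ≡ c′
equidistant-unique a b c c′ a≢b eq eq′ = c+c-injective c c′
  (trans (sym (equidistant⇒midpoint a b c eq a≢b)) (equidistant⇒midpoint a b c′ eq′ a≢b))

AtMostOneUnresolving : ∀ {n} → (Fin n → Fin n → ℕ) → Set
AtMostOneUnresolving {n} d =
  ∀ (x y : Fin n) → x ≢ y → ∀ v w → d x v ≡ d y v → d x w ≡ d y w → v ≡ w

-- Under that hypothesis every set of at least k + 1 vertices is a k-metric
-- generator: drop the unique unresolving vertex (if there is one) from S.
largeSetsGenerate : ∀ {n} {d : Fin n → Fin n → ℕ} {k} → AtMostOneUnresolving d →
  ∀ S → suc k ≤ ∣ S ∣ → IsKMetricGenerator d k S
largeSetsGenerate {d = d} {k} unique S k<∣S∣ x y x≢y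
  with any? (λ v → d x v ≟ d y v)
... | yes (v , unresolved) = S - v , k≤∣S-v∣ , resolving
  where
  k≤∣S-v∣ : k ≤ ∣ S - v ∣
  k≤∣S-v∣ = s≤s⁻¹ (≤-trans k<∣S∣ (∣p∣≤1+∣p-x∣ S v))
  resolving : ∀ w → w ∈ S - v → (w ∈ S) × ¬ (d x w ≡ d y w)
  resolving w w∈S-v = p─q⊆p S ⁅ v ⁆ w∈S-v ,
    λ eq → ∈-⇒≢ S w∈S-v (unique x y x≢y w v eq unresolved)
... | no allResolve = S , ≤-trans (n≤1+n k) k<∣S∣ ,
  λ w w∈S → w∈S , λ eq → allResolve (w , eq)

generatorSize : ∀ {n} {d : Fin n → Fin n → ℕ} {k S} (x y : Fin n) → x ≢ y →
  IsKMetricGenerator d k S → k ≤ ∣ S ∣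
generatorSize x y x≢y gen with gen x y x≢y
... | R , k≤∣R∣ , R-resolves =
  ≤-trans k≤∣R∣ (p⊆q⇒∣p∣≤∣q∣ (λ {w} w∈R → proj₁ (R-resolves w w∈R)))

-- If some member w of a k-metric generator S fails to resolve a pair, the k
-- resolving vertices of that pair lie in S - w, so S has at least k + 1 elements.
unresolvingMember : ∀ {n} {d : Fin n → Fin n → ℕ} {k S} {x y w : Fin n} →
  IsKMetricGenerator d k S → w ∈ S → x ≢ y → d x w ≡ d y w → suc k ≤ ∣ S ∣
unresolvingMember {S = S} {w = w} gen w∈S x≢y unresolved with gen _ _ x≢y
... | R , k≤∣R∣ , R-resolves =
  ≤-trans (s≤s (≤-trans k≤∣R∣ (p⊆q⇒∣p∣≤∣q∣ R⊆S-w))) (x∈p⇒∣p-x∣<∣p∣ w∈S)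
  where
  R⊆S-w : R ⊆ S - w
  R⊆S-w {v} v∈R = x∈p∧x≢y⇒x∈p-y (proj₁ (R-resolves v v∈R))
    (λ { refl → proj₂ (R-resolves v v∈R) unresolved })

pathUnresolving : ∀ {n} {d : Fin n → Fin n → ℕ} → IsShortestPathDistance (PathGraph n) d →
  AtMostOneUnresolving d
pathUnresolving {d = d} sp x y x≢y v w eqv eqw = toℕ-injective
  (equidistant-unique (toℕ x) (toℕ y) (toℕ v) (toℕ w) (λ eq → x≢y (toℕ-injective eq))
    (toDist x y v eqv) (toDist x y w eqw))
  where
  toDist : ∀ x y z → d x z ≡ d y z → dist (toℕ x) (toℕ z) ≡ dist (toℕ y) (toℕ z)
  toDist x y z eq = trans (sym (pathDistance sp x z)) (trans eq (pathDistance sp y z))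

interiorVertexUnresolving : ∀ {m} {d : Fin (suc m) → Fin (suc m) → ℕ} →
  IsShortestPathDistance (PathGraph (suc m)) d →
  ∀ w → w ≢ fz → m ≢ toℕ w → ∃₂ λ x y → x ≢ y × d x w ≡ d y w
interiorVertexUnresolving sp fz w≢0 _ = contradiction refl w≢0
interiorVertexUnresolving {d = d} sp (fs w) _ w≢last =
  left , right , left≢right , trans (neighbour left-adj) (sym (neighbour right-adj))
  where
  left = inject₁ w
  right = fs (lower₁ (fs w) w≢last)
  right-index : toℕ right ≡ suc (suc (toℕ w))
  right-index = cong suc (toℕ-lower₁ (fs w) w≢last)
  left-adj : PathGraph _ left (fs w)
  left-adj = inj₁ (cong suc (toℕ-inject₁ w))
  right-adj : PathGraph _ right (fs w)
  right-adj = inj₂ (sym right-index)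
  neighbour : ∀ {u} → PathGraph _ u (fs w) → d u (fs w) ≡ 1
  neighbour adj = trans (pathDistance sp _ _) (adjacent⇒dist≡1 adj)
  left≢right : left ≢ right
  left≢right eq = <⇒≢ (≤-trans (n<1+n (toℕ w)) (n≤1+n _))
    (trans (sym (toℕ-inject₁ w)) (trans (cong toℕ eq) right-index))

-- Lower bound: for k ≥ 3, a k-metric generator of P_n (n ≥ 2) contains an interior
-- vertex, and therefore has at least k + 1 elements.
pathLowerBound : ∀ {k n} → 3 ≤ k → 2 ≤ n →
  ∀ {d : Fin n → Fin n → ℕ} → IsShortestPathDistance (PathGraph n) d →
  ∀ S → IsKMetricGenerator d k S → suc k ≤ ∣ S ∣
pathLowerBound {k} {suc (suc m)} 3≤k (s≤s (s≤s _)) sp S gen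
  with positiveSize⇒nonempty (S - fz - last) interiorMembers
  where
  last = fromℕ (suc m)
  3≤∣S∣ : 3 ≤ ∣ S ∣
  3≤∣S∣ = ≤-trans 3≤k (generatorSize fz (fs fz) (λ ()) gen)
  interiorMembers : 1 ≤ ∣ S - fz - last ∣
  interiorMembers = s≤s⁻¹ (s≤s⁻¹ (≤-trans 3≤∣S∣
    (≤-trans (∣p∣≤1+∣p-x∣ S fz) (s≤s (∣p∣≤1+∣p-x∣ (S - fz) last)))))
... | w , w∈S-fz-last with interiorVertexUnresolving sp w w≢0 w≢last
  where
  w∈S-fz : w ∈ S - fz
  w∈S-fz = p─q⊆p (S - fz) _ w∈S-fz-last
  w≢0 : w ≢ fz
  w≢0 = ∈-⇒≢ S w∈S-fz
  w≢last : suc m ≢ toℕ w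
  w≢last eq = ∈-⇒≢ (S - fz) w∈S-fz-last (toℕ-injective (trans (sym eq) (sym (toℕ-fromℕ (suc m)))))
... | x , y , x≢y , unresolved =
  unresolvingMember gen (p─q⊆p S _ (p─q⊆p (S - fz) _ w∈S-fz-last)) x≢y unresolved

proposition25 : (k n : ℕ) → 3 ≤ k → k + 1 ≤ n →
    (d : Fin n → Fin n → ℕ) → IsShortestPathDistance (PathGraph n) d →
    IsKMetricDimension d k (k + 1)
proposition25 k n 3≤k k+1≤n d sp with subsetOfSize (k + 1) n k+1≤n
... | S , ∣S∣≡k+1 = (S , generator , ∣S∣≡k+1) , minimal
  where
  k+1≡1+k : k + 1 ≡ suc k
  k+1≡1+k = +-comm k 1
  generator : IsKMetricGenerator d k S
  generator = largeSetsGenerate (pathUnresolving sp) S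
    (≤-reflexive (trans (sym k+1≡1+k) (sym ∣S∣≡k+1)))
  2≤n : 2 ≤ n
  2≤n = ≤-trans (≤-trans (n≤1+n 2) 3≤k) (≤-trans (m≤m+n k 1) k+1≤n)
  minimal : ∀ T → IsKMetricGenerator d k T → k + 1 ≤ ∣ T ∣
  minimal T gen = subst (_≤ ∣ T ∣) (sym k+1≡1+k) (pathLowerBound 3≤k 2≤n sp T gen)
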